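{- For positive integers $a, b$ define $$P_{ab}(x,y,z) = a^2y^2z+abxyz+aby^3+b^2xy^2+ax^2z+axy^2-2ayz^2+2bx^2y-bxz^2-by^2z+x^3-3xyz+y^3+z^3,$$ and let $F_{ab}:\mathbb{Z}^3\to\mathbb{Z}^3$ be the bijection $F_{ab}(x,y,z) = (y, z, az + by + x)$ (one step forward of the recurrence $u(n) = a\,u(n-1) + b\,u(n-2) + u(n-3)$), with inverse $F_{ab}^{ -1}(x,y,z) = (z - ay - bx, x, y)$. For every positive integer $b$ there exists $A(b)$ such that for every integer $a \ge A(b)$ for which $X^3 - aX^2 - bX - 1$ is irreducible over $\mathbb{Q}$ and has a unique root of largest absolute value, which is real and greater than $1$, the following holds: there is a finite set $\mathcal{F}$ of integer solutions of $P_{ab} = 1$ such that every integer solution $(x,y,z)$ of $P_{ab}(x,y,z) = 1$ is of the form $F_{ab}^n(s)$ for some $s \in \mathcal{F}$ and some integer $n$.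
   Context: For $n \ge 0$, $F_{ab}^n$ is the $n$-fold composition of $F_{ab}$ and $F_{ab}^{ -n}$ the $n$-fold composition of $F_{ab}^{ -1}$. -}

module Defs where

open import Data.Nat using (ℕ; zero; suc)
open import Data.Integer as Z using (ℤ; +_; -[1+_])
open import Data.Rational as Q using (ℚ; 0ℚ)
open import Data.List using (List; []; _∷_; map)
open import Data.Product using (_×_; _,_; ∃)
open import Data.Sum using (_⊎_)
open import Relation.Nullary using (¬_)
open import Relation.Binary.PropositionalEquality using (_≡_; _≢_)
open import Function using (_∘_)

P : ℤ → ℤ → ℤ → ℤ → ℤ → ℤ
P a b x y z =
  let open Z in
  a * a * y * y * z + a * b * x * y * z + a * b * y * y * y
  + b * b * x * y * y + a * x * x * z + a * x * y * y
  - + 2 * a * y * z * z + + 2 * b * x * x * y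
  - b * x * z * z - b * y * y * z + x * x * x
  - + 3 * x * y * z + y * y * y + z * z * z

ℤ³ : Set
ℤ³ = ℤ × ℤ × ℤ

F : ℤ → ℤ → ℤ³ → ℤ³
F a b (x , y , z) = y , z , (a Z.* z Z.+ b Z.* y Z.+ x)

Finv : ℤ → ℤ → ℤ³ → ℤ³
Finv a b (x , y , z) = (z Z.- a Z.* y Z.- b Z.* x) , x , y

iter : (ℤ³ → ℤ³) → ℕ → ℤ³ → ℤ³
iter f zero    s = s
iter f (suc n) s = f (iter f n s)

Fpow : ℤ → ℤ → ℤ → ℤ³ → ℤ³
Fpow a b (+ n)      = iter (F a b) n
Fpow a b -[1+ n ]   = iter (Finv a b) (suc n)

-- Univariate polynomials over ℚ as coefficient lists (constant term first)

Poly : Set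
Poly = List ℚ

coeff : Poly → ℕ → ℚ
coeff []       _       = 0ℚ
coeff (c ∷ p)  zero    = c
coeff (c ∷ p)  (suc i) = coeff p i

_⊕_ : Poly → Poly → Poly
[]      ⊕ q       = q
(c ∷ p) ⊕ []      = c ∷ p
(c ∷ p) ⊕ (d ∷ q) = (c Q.+ d) ∷ (p ⊕ q)

_⊛_ : Poly → Poly → Poly
[]      ⊛ q = []
(c ∷ p) ⊛ q = map (c Q.*_) q ⊕ (0ℚ ∷ (p ⊛ q))

-- equality of polynomials (coefficientwise, ignoring trailing zeros)
_≈ₚ_ : Poly → Poly → Set
p ≈ₚ q = ∀ i → coeff p i ≡ coeff q i

NonConstant : Poly → Set
NonConstant p = ∃ λ i → coeff p (suc i) ≢ 0ℚ

IrreducibleQ : Poly → Set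
IrreducibleQ f = NonConstant f × (∀ p q → (p ⊛ q) ≈ₚ f → ¬ NonConstant p ⊎ ¬ NonConstant q)

ℤ→ℚ : ℤ → ℚ
ℤ→ℚ n = n Q./ 1

cubic : ℤ → ℤ → Poly
cubic a b = ℤ→ℚ (Z.- + 1) ∷ ℤ→ℚ (Z.- b) ∷ ℤ→ℚ (Z.- a) ∷ ℤ→ℚ (+ 1) ∷ []

{-# OPTIONS --safe #-}
-- Let w = a z + b y + x be the next term of the recurrence, so that F (x, y, z) = (y, z, w), and
-- measure a point by M = x² + a y² + w².  P is F-invariant and a P = w Q + R with
-- Q = a (x² + a y²) + z² + b y² and R = w D + E of lower order.  If w² is tiny compared with
-- G = x² + a y², one step of F lowers M; if it is huge, one step of F⁻¹ does: both are polynomial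
-- inequalities between absolute values that hold once a ≥ 4096 b².  In the remaining range
-- |R| ≤ ¾ a |w| G, so P = 1 forces |w| G ≤ 4, which leaves only (1, 0, 0).  Descent on M thus
-- carries every solution of P = 1 to (1, 0, 0).
module Submission where

open import Defs
open import Data.Nat using (ℕ; _≤_)
open import Data.Integer using (ℤ; +_)
open import Data.List using (List)
open import Data.List.Membership.Propositional using (_∈_)
open import Data.List.Relation.Unary.All using (All)
open import Data.Product using (Σ; _×_; _,_; ∃; proj₁; proj₂)
open import Relation.Binary.PropositionalEquality using (_≡_)

open import Data.Empty using (⊥-elim)
open import Data.Integer using (-[1+_]; ∣_∣)
import Data.Integer as ℤ
import Data.Integer.Properties as ℤₚ
open import Algebra.Properties.AbelianGroup ℤₚ.+-0-abelianGroup using (//-rightDividesʳ)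
import Data.Integer.Tactic.RingSolver as ℤ-Solver
open import Data.List using ([]; _∷_)
import Data.List.Relation.Unary.All as All
open import Data.List.Relation.Unary.Any using (here)
open import Data.Nat using (zero; suc; _+_; _*_; _^_; _<_; _≤?_; s≤s; z≤n; NonZero; >-nonZero)
open import Data.Nat.Induction using (<-wellFounded)
open import Data.Nat.Properties
open import Data.Nat.Tactic.RingSolver using (solve)
open import Data.Sum using ([_,_]′)
import Data.Vec as Vec
open import Function using (_∘_)
open import Induction.WellFounded using (Acc; acc)
open import Relation.Binary.PropositionalEquality
  using (refl; sym; trans; cong; cong₂; subst; subst₂; module ≡-Reasoning)
open import Relation.Nullary using (¬_; yes; no)
open import Tactic.RingSolver.NonReflective ℤ-Solver.ring using (_⊜_; module Ops; Expr; Κ; Ι; ⊝_)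
  renaming (solve to solve-ℤ; _⊕_ to infixl 6 _:+_; _⊗_ to infixl 7 _:*_; _⊛_ to infixr 8 _:^_)
open Ops using (⟦_⟧)

-- A certificate for l ≤ r: hypotheses lᵢ ≤ rᵢ with multipliers cᵢ, combined by ⊠ and ⊞
-- below, and σ with nonnegative coefficients such that r + Σ cᵢ lᵢ = l + Σ cᵢ rᵢ + σ.
≤-by-certificate : ∀ {l r mₗ mᵣ} σ → mₗ ≤ mᵣ → r + mₗ ≡ l + mᵣ + σ → l ≤ r
≤-by-certificate {l} {r} {mₗ} {mᵣ} σ mₗ≤mᵣ eq = +-cancelʳ-≤ mₗ l r (begin
  l + mₗ      ≤⟨ +-monoʳ-≤ l mₗ≤mᵣ ⟩
  l + mᵣ      ≤⟨ m≤m+n (l + mᵣ) σ ⟩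
  l + mᵣ + σ  ≡⟨ sym eq ⟩
  r + mₗ      ∎)
  where open ≤-Reasoning

infix  5 _⊠_
infixl 4 _⊞_

_⊠_ : ∀ c {m n} → m ≤ n → c * m ≤ c * n
_⊠_ = *-monoʳ-≤

_⊞_ : ∀ {m n p q} → m ≤ n → p ≤ q → m + p ≤ n + q
_⊞_ = +-mono-≤

square-≤⇒≤ : ∀ {m n} → m * m ≤ n * n → m ≤ n
square-≤⇒≤ m²≤n² = ≮⇒≥ (λ n<m → <⇒≱ (*-mono-< n<m n<m) m²≤n²)

square-<⇒< : ∀ {m n} → m * m < n * n → m < n
square-<⇒< m²<n² = ≰⇒> (λ n≤m → <⇒≱ m²<n² (*-mono-≤ n≤m n≤m))

square≡0⇒≡0 : ∀ {n} → n * n ≡ 0 → n ≡ 0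
square≡0⇒≡0 {zero} _ = refl

2mn≤m²+n² : ∀ m n → 2 * (m * n) ≤ m * m + n * n
2mn≤m²+n² m n = [ ordered , swapped ]′ (≤-total m n)
  where
  ordered : ∀ {m n} → m ≤ n → 2 * (m * n) ≤ m * m + n * n
  ordered {m} m≤n with m≤n⇒∃[o]m+o≡n m≤n
  ... | d , refl = ≤-by-certificate (d * d) (z≤n {0}) (solve (m ∷ d ∷ []))
  swapped : n ≤ m → 2 * (m * n) ≤ m * m + n * n
  swapped n≤m = subst₂ _≤_ (cong (2 *_) (*-comm n m)) (+-comm (n * n) (m * m)) (ordered n≤m)

square-sum≤ : ∀ {u} p q r → u ≤ p + q + r → u * u ≤ 3 * (p * p + q * q + r * r)
square-sum≤ {u} p q r u≤ = ≤-trans (*-mono-≤ u≤ u≤)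
  (≤-by-certificate 0 (2mn≤m²+n² p q ⊞ 2mn≤m²+n² q r ⊞ 2mn≤m²+n² p r) (solve (p ∷ q ∷ r ∷ [])))

small-multiple≡0 : ∀ {a n c} → c < a → a * n ≤ c → n ≡ 0
small-multiple≡0 {n = zero} _ _ = refl
small-multiple≡0 {a} {suc n} c<a an≤c = ⊥-elim (<⇒≱ c<a (≤-trans (m≤m*n a (suc n)) an≤c))

⟦_⟧₀ : Expr ℤ 0 → ℤ
⟦ e ⟧₀ = ⟦ e ⟧ Vec.[]

infixl 6 _:-_
_:-_ : ∀ {n} → Expr ℤ n → Expr ℤ n → Expr ℤ n
p :- q = p :+ ⊝ q

majorant : Expr ℤ 0 → ℕ
majorant (Κ c)    = ∣ c ∣
majorant (Ι ())
majorant (e :+ f) = majorant e + majorant f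
majorant (e :* f) = majorant e * majorant f
majorant (e :^ k) = majorant e ^ k
majorant (⊝ e)    = majorant e

∣⟦⟧∣≤majorant : ∀ e → ∣ ⟦ e ⟧₀ ∣ ≤ majorant e
∣⟦⟧∣≤majorant (Κ c)    = ≤-refl
∣⟦⟧∣≤majorant (e :+ f) =
  ≤-trans (ℤₚ.∣i+j∣≤∣i∣+∣j∣ ⟦ e ⟧₀ ⟦ f ⟧₀) (∣⟦⟧∣≤majorant e ⊞ ∣⟦⟧∣≤majorant f)
∣⟦⟧∣≤majorant (e :* f) =
  ≤-trans (≤-reflexive (ℤₚ.abs-* ⟦ e ⟧₀ ⟦ f ⟧₀)) (*-mono-≤ (∣⟦⟧∣≤majorant e) (∣⟦⟧∣≤majorant f))
∣⟦⟧∣≤majorant (⊝ e)    = ≤-trans (≤-reflexive (ℤₚ.∣-i∣≡∣i∣ ⟦ e ⟧₀)) (∣⟦⟧∣≤majorant e)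
∣⟦⟧∣≤majorant (e :^ k) = power k
  where
  power : ∀ k → ∣ ⟦ e :^ k ⟧₀ ∣ ≤ majorant e ^ k
  power zero          = ≤-refl
  power (suc zero)    = ≤-trans (∣⟦⟧∣≤majorant e) (≤-reflexive (sym (*-identityʳ (majorant e))))
  power (suc (suc k)) = begin
    ∣ ⟦ e :^ suc k ⟧₀ ℤ.* ⟦ e ⟧₀ ∣     ≡⟨ ℤₚ.abs-* ⟦ e :^ suc k ⟧₀ ⟦ e ⟧₀ ⟩
    ∣ ⟦ e :^ suc k ⟧₀ ∣ * ∣ ⟦ e ⟧₀ ∣   ≤⟨ *-mono-≤ (power (suc k)) (∣⟦⟧∣≤majorant e) ⟩
    majorant e ^ suc k * majorant e    ≡⟨ *-comm (majorant e ^ suc k) (majorant e) ⟩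
    majorant e ^ suc (suc k)           ∎
    where open ≤-Reasoning

∣i∣≤∣i+j∣+∣j∣ : ∀ i j → ∣ i ∣ ≤ ∣ i ℤ.+ j ∣ + ∣ j ∣
∣i∣≤∣i+j∣+∣j∣ i j =
  subst (_≤ ∣ i ℤ.+ j ∣ + ∣ j ∣) (cong ∣_∣ (//-rightDividesʳ j i)) (ℤₚ.∣i-j∣≤∣i∣+∣j∣ (i ℤ.+ j) j)

square≡+∣∣² : ∀ i → i ℤ.* i ≡ + (∣ i ∣ * ∣ i ∣)
square≡+∣∣² (+ n)    = sym (ℤₚ.pos-* n n)
square≡+∣∣² -[1+ n ] = refl

cube≡1⇒≡1 : ∀ x → x ℤ.* x ℤ.* x ≡ + 1 → x ≡ + 1
cube≡1⇒≡1 x x³≡1 =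
  by-sign x x³≡1 (m*n≡1⇒n≡1 ∣ x ℤ.* x ∣ ∣ x ∣ (trans (sym (ℤₚ.abs-* (x ℤ.* x) x)) (cong ∣_∣ x³≡1)))
  where
  by-sign : ∀ x → x ℤ.* x ℤ.* x ≡ + 1 → ∣ x ∣ ≡ 1 → x ≡ + 1
  by-sign (+ 1)           _  _  = refl
  by-sign -[1+ 0 ]        () _
  by-sign (+ 0)           _  ()
  by-sign (+ suc (suc _)) _  ()
  by-sign -[1+ suc _ ]    _  ()

Poly₅ : Set
Poly₅ = ∀ {n} → Expr ℤ n → Expr ℤ n → Expr ℤ n → Expr ℤ n → Expr ℤ n → Expr ℤ n

-- ⟪ Pₑ ⟫ is definitionally P; this is how the solver identities below reach P.
nextₑ prevₑ Pₑ Qₑ Dₑ Eₑ : Poly₅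
nextₑ a b x y z = a :* z :+ b :* y :+ x
prevₑ a b x y z = z :- a :* y :- b :* x
Pₑ a b x y z = a :* a :* y :* y :* z :+ a :* b :* x :* y :* z :+ a :* b :* y :* y :* y
  :+ b :* b :* x :* y :* y :+ a :* x :* x :* z :+ a :* x :* y :* y
  :- Κ (+ 2) :* a :* y :* z :* z :+ Κ (+ 2) :* b :* x :* x :* y
  :- b :* x :* z :* z :- b :* y :* y :* z :+ x :* x :* x
  :- Κ (+ 3) :* x :* y :* z :+ y :* y :* y :+ z :* z :* z
Qₑ a b x y z = a :* (x :* x :+ a :* (y :* y)) :+ z :* z :+ b :* (y :* y)
Dₑ a b x y z = a :* b :* x :* y :- Κ (+ 2) :* a :* y :* z :- x :* y :- b :* x :* z
Eₑ a b x y z = a :* y :* y :* y :+ b :* b :* x :* y :* z :+ b :* x :* x :* z :+ x :* x :* y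
  :- b :* b :* y :* y :* y :- b :* y :* z :* z :- x :* z :* z

at : Poly₅ → ℤ → ℤ → ℤ → ℤ → ℤ → Expr ℤ 0
at f A B x y z = f (Κ A) (Κ B) (Κ x) (Κ y) (Κ z)

⟪_⟫ : Poly₅ → ℤ → ℤ → ℤ → ℤ → ℤ → ℤ
⟪ f ⟫ A B x y z = ⟦ at f A B x y z ⟧₀

next prev Q : ℤ → ℤ → ℤ → ℤ → ℤ → ℤ
next = ⟪ nextₑ ⟫
prev = ⟪ prevₑ ⟫
Q    = ⟪ Qₑ ⟫

P-F-invariant : ∀ A B x y z → P A B y z (next A B x y z) ≡ P A B x y z
P-F-invariant = solve-ℤ 5 (λ a b x y z → Pₑ a b y z (nextₑ a b x y z) ⊜ Pₑ a b x y z) refl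

P-Finv-invariant : ∀ A B x y z → P A B (prev A B x y z) x y ≡ P A B x y z
P-Finv-invariant = solve-ℤ 5 (λ a b x y z → Pₑ a b (prevₑ a b x y z) x y ⊜ Pₑ a b x y z) refl

P-x00 : ∀ A B x → P A B x (+ 0) (+ 0) ≡ x ℤ.* x ℤ.* x
P-x00 = solve-ℤ 3 (λ a b x → Pₑ a b x (Κ (+ 0)) (Κ (+ 0)) ⊜ x :* x :* x) refl

P-decomposition : ∀ A B x y z → let w = next A B x y z in
  A ℤ.* P A B x y z ≡ w ℤ.* Q A B x y z ℤ.+ (w ℤ.* ⟪ Dₑ ⟫ A B x y z ℤ.+ ⟪ Eₑ ⟫ A B x y z)
P-decomposition = solve-ℤ 5 (λ a b x y z → let w = nextₑ a b x y z in
  a :* Pₑ a b x y z ⊜ (w :* Qₑ a b x y z :+ (w :* Dₑ a b x y z :+ Eₑ a b x y z))) refl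

next-prev : ∀ A B x y z → next A B (prev A B x y z) x y ≡ z
next-prev = solve-ℤ 5 (λ a b x y z → nextₑ a b (prevₑ a b x y z) x y ⊜ z) refl

prev-next : ∀ A B x y z → prev A B y z (next A B x y z) ≡ x
prev-next = solve-ℤ 5 (λ a b x y z → prevₑ a b y z (nextₑ a b x y z) ⊜ x) refl

Az≡next-By-x : ∀ A B x y z → A ℤ.* z ≡ next A B x y z ℤ.- B ℤ.* y ℤ.- x
Az≡next-By-x = solve-ℤ 5 (λ a b x y z → a :* z ⊜ (nextₑ a b x y z :- b :* y :- x)) refl

F-Finv : ∀ A B t → F A B (Finv A B t) ≡ t
F-Finv A B (x , y , z) = cong (λ u → x , y , u) (next-prev A B x y z)

Finv-F : ∀ A B t → Finv A B (F A B t) ≡ t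
Finv-F A B (x , y , z) = cong (λ u → u , y , z) (prev-next A B x y z)

Orbit : ℤ → ℤ → ℤ³ → ℤ³ → Set
Orbit A B s t = ∃ λ n → Fpow A B n s ≡ t

module _ {A B : ℤ} {s : ℤ³} where

  orbit-F : ∀ {t} → Orbit A B s t → Orbit A B s (F A B t)
  orbit-F (+ n            , refl) = + suc n , refl
  orbit-F (-[1+ zero ]    , refl) = + 0 , sym (F-Finv A B s)
  orbit-F (-[1+ suc n ]   , refl) = -[1+ n ] , sym (F-Finv A B _)

  orbit-Finv : ∀ {t} → Orbit A B s t → Orbit A B s (Finv A B t)
  orbit-Finv (+ zero   , refl) = -[1+ 0 ] , refl
  orbit-Finv (+ suc n  , refl) = + n , sym (Finv-F A B _)
  orbit-Finv (-[1+ n ] , refl) = -[1+ suc n ] , refl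

  orbit-F⁻¹ : ∀ {t} → Orbit A B s (F A B t) → Orbit A B s t
  orbit-F⁻¹ {t} = subst (Orbit A B s) (Finv-F A B t) ∘ orbit-Finv

  orbit-Finv⁻¹ : ∀ {t} → Orbit A B s (Finv A B t) → Orbit A B s t
  orbit-Finv⁻¹ {t} = subst (Orbit A B s) (F-Finv A B t) ∘ orbit-F

module Estimates {a b : ℕ} (1≤b : 1 ≤ b) (4096b²≤a : 4096 * b * b ≤ a) where

  4096≤a : 4096 ≤ a
  4096≤a = ≤-trans (*-mono-≤ (4096 ⊠ 1≤b) 1≤b) 4096b²≤a

  1≤a : 1 ≤ a
  1≤a = ≤-trans (s≤s z≤n) 4096≤a

  instance
    a≢0 : NonZero a
    a≢0 = >-nonZero 1≤a

    a²≢0 : NonZero (a * a)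
    a²≢0 = m*n≢0 a a

  measure≡0 : ∀ {X Y Z W} → a * Z ≤ W + b * Y + X → X * X + a * (Y * Y) + W * W ≡ 0 →
    X ≡ 0 × Y ≡ 0 × Z ≡ 0
  measure≡0 {X} {Y} {Z} {W} aZ≤ M≡0 = X≡0 , Y≡0 , Z≡0
    where
    G≡0 : X * X + a * (Y * Y) ≡ 0
    G≡0 = m+n≡0⇒m≡0 _ M≡0
    X≡0 : X ≡ 0
    X≡0 = square≡0⇒≡0 (m+n≡0⇒m≡0 _ G≡0)
    Y≡0 : Y ≡ 0
    Y≡0 = square≡0⇒≡0 (m*n≡0⇒m≡0 (Y * Y) a (trans (*-comm (Y * Y) a) (m+n≡0⇒n≡0 (X * X) G≡0)))
    W≡0 : W ≡ 0
    W≡0 = square≡0⇒≡0 (m+n≡0⇒n≡0 (X * X + a * (Y * Y)) M≡0)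
    Z≡0 : Z ≡ 0
    Z≡0 = small-multiple≡0 1≤a (≤-trans aZ≤ (≤-reflexive
      (cong₂ _+_ (cong₂ _+_ W≡0 (trans (cong (b *_) Y≡0) (*-zeroʳ b))) X≡0)))

  1≤G-in-regime-F : ∀ {G S} → 1 ≤ G + S → 16 * (a * a * S) ≤ G → 1 ≤ G
  1≤G-in-regime-F {zero}  1≤S S-small =
    ≤-trans (*-mono-≤ {1} {16} (s≤s z≤n) (*-mono-≤ (*-mono-≤ 1≤a 1≤a) 1≤S)) S-small
  1≤G-in-regime-F {suc _} _   _       = s≤s z≤n

  1≤S-in-regime-Finv : ∀ {G S} → 1 ≤ G + S → 16 * (a * G) ≤ S → 1 ≤ S
  1≤S-in-regime-Finv {zero}  1≤S _       = 1≤S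
  1≤S-in-regime-Finv {suc _} _   S-large =
    ≤-trans (*-mono-≤ {1} {16} (s≤s z≤n) (*-mono-≤ 1≤a (s≤s z≤n))) S-large

  -- The certificates below have denominators dividing 16 a².  The conclusion is suc L ≤ R rather
  -- than L < R so that L and R are fixed by unification before the ring solver reads the goal.
  cancel-16a² : ∀ {L R} → 16 * (1 + a * a * L) ≤ 16 * (a * a * R) → suc L ≤ R
  cancel-16a² {L} {R} h = *-cancelˡ-< (a * a) L R (*-cancelˡ-≤ 16 h)

  -- G stands for x² + a y²; keeping it abstract keeps the ring solver fast.
  F-step-decreases : ∀ {X Y Z W U G} → X * X ≤ G → a * (Y * Y) ≤ G → 1 ≤ G →
    16 * (a * a * (W * W)) ≤ G → a * Z ≤ W + b * Y + X → U ≤ a * W + b * Z + Y →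
    Y * Y + a * (Z * Z) + U * U < G + W * W
  F-step-decreases {X} {Y} {Z} {W} {U} {G} X²≤G aY²≤G 1≤G W-small aZ≤ U≤ =
    cancel-16a² (≤-by-certificate
      (31 * a * a * W * W + 12 * a * a * G + 3983 * a * b * b * G
        + 3952 * b * b * b * b * Y * Y + 3952 * b * b * W * W + 3883 * b * b * G)
      ( (3 * a * a + 4) ⊠ W-small
      ⊞ 16 ⊠ 1≤G
      ⊞ (64 * a + 49 * b * b) ⊠ aY²≤G
      ⊞ (48 * a + 144 * b * b) ⊠ X²≤G
      ⊞ (16 * a + 48 * b * b) ⊠ square-sum≤ W (b * Y) X aZ≤
      ⊞ (16 * a * a) ⊠ square-sum≤ (a * W) (b * Z) Y U≤
      ⊞ (a * G + b * b * Y * Y + W * W + G) ⊠ 4096b²≤a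
      ⊞ (113 * a * b * G + 113 * a * G + 20 * b * G + 20 * G) ⊠ 1≤b
      ⊞ (49 * a * W * W) ⊠ 1≤a)
      (solve (a ∷ b ∷ X ∷ Y ∷ Z ∷ W ∷ U ∷ G ∷ [])))

  Finv-step-decreases : ∀ {X Y Z W V G} → X * X ≤ G → a * (Y * Y) ≤ G → 1 ≤ W * W →
    16 * (a * G) ≤ W * W → a * Z ≤ W + b * Y + X → V ≤ Z + a * Y + b * X →
    V * V + a * (X * X) + Z * Z < G + W * W
  Finv-step-decreases {X} {Y} {Z} {W} {V} {G} X²≤G aY²≤G 1≤W² W-large aZ≤ V≤ =
    cancel-16a² (≤-by-certificate
      (15 * a * a * a * G + 4048 * a * a * b * b * G + 10 * a * a * W * W + 15 * a * a * G
        + 4095 * a * b * b * W * W + 4095 * a * b * b * G + 3904 * b * b * Y * Y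
        + 3888 * b * b * W * W + 3903 * b * b * G)
      ( (5 * a * a) ⊠ W-large
      ⊞ 16 ⊠ 1≤W²
      ⊞ (48 * a * a * a + 1) ⊠ aY²≤G
      ⊞ (16 * a * a * a + 48 * a * a * b * b + 192) ⊠ X²≤G
      ⊞ 64 ⊠ square-sum≤ W (b * Y) X aZ≤
      ⊞ (16 * a * a) ⊠ square-sum≤ Z (a * Y) (b * X) V≤
      ⊞ (a * a * G + a * W * W + a * G + Y * Y + W * W + G) ⊠ 4096b²≤a
      ⊞ (a * b * W * W + a * b * G + a * W * W + a * G + 208 * b * W * W + 193 * b * G
          + 208 * W * W + 193 * G) ⊠ 1≤b)
      (solve (a ∷ b ∷ X ∷ Y ∷ Z ∷ W ∷ V ∷ G ∷ [])))

  <16a²n²⇒1≤n : ∀ {m n} → m < 16 * (a * a * (n * n)) → 1 ≤ n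
  <16a²n²⇒1≤n {m} {zero} m<0 = ⊥-elim (n≮0 (subst (m <_) (cong (16 *_) (*-zeroʳ (a * a))) m<0))
  <16a²n²⇒1≤n {n = suc _} _ = s≤s z≤n

  <16an⇒1≤n : ∀ {m n} → m < 16 * (a * n) → 1 ≤ n
  <16an⇒1≤n {m} {zero} m<0 = ⊥-elim (n≮0 (subst (m <_) (cong (16 *_) (*-zeroʳ a)) m<0))
  <16an⇒1≤n {n = suc _} _ = s≤s z≤n

  module Middle {X Y W G : ℕ} (G-bound : X * X + a * (Y * Y) ≤ G)
    (W-not-small : G < 16 * (a * a * (W * W))) (W-not-large : W * W < 16 * (a * G)) where

    X²≤G : X * X ≤ G
    X²≤G = ≤-trans (m≤m+n (X * X) (a * (Y * Y))) G-bound

    aY²≤G : a * (Y * Y) ≤ G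
    aY²≤G = ≤-trans (m≤n+m (a * (Y * Y)) (X * X)) G-bound

    1≤W : 1 ≤ W
    1≤W = <16a²n²⇒1≤n W-not-small

    1≤G : 1 ≤ G
    1≤G = <16an⇒1≤n W-not-large

    X≤4aW : X ≤ 4 * a * W
    X≤4aW = <⇒≤ (square-<⇒< (begin-strict
      X * X                  ≤⟨ X²≤G ⟩
      G                      <⟨ W-not-small ⟩
      16 * (a * a * (W * W)) ≡⟨ solve (a ∷ W ∷ []) ⟩
      4 * a * W * (4 * a * W) ∎))
      where open ≤-Reasoning

    16Y≤aW : 16 * Y ≤ a * W
    16Y≤aW = square-≤⇒≤ (≤-by-certificate 0
      (256 ⊠ <⇒≤ Y²<16aW² ⊞ (a * (W * W)) ⊠ 4096≤a) (solve (a ∷ Y ∷ W ∷ [])))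
      where
      Y²<16aW² : Y * Y < 16 * (a * (W * W))
      Y²<16aW² = *-cancelˡ-< a _ _ (begin-strict
        a * (Y * Y)                ≤⟨ aY²≤G ⟩
        G                          <⟨ W-not-small ⟩
        16 * (a * a * (W * W))     ≡⟨ solve (a ∷ W ∷ []) ⟩
        a * (16 * (a * (W * W)))   ∎)
        where open ≤-Reasoning

    YW≤4G : Y * W ≤ 4 * G
    YW≤4G = square-≤⇒≤ (*-cancelˡ-≤ a (≤-by-certificate 0
      ((W * W) ⊠ aY²≤G ⊞ G ⊠ <⇒≤ W-not-large) (solve (a ∷ Y ∷ W ∷ G ∷ []))))

    2XW≤aG+16G : 2 * X * W ≤ a * G + 16 * G
    2XW≤aG+16G = *-cancelˡ-≤ a (≤-by-certificate 0
      (2mn≤m²+n² (a * X) W ⊞ (a * a) ⊠ X²≤G ⊞ <⇒≤ W-not-large) (solve (a ∷ X ∷ W ∷ G ∷ [])))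

    16bXY≤G : 16 * b * X * Y ≤ G
    16bXY≤G = ≤-trans 16bXY≤X²+aY² G-bound
      where
      16bXY≤X²+aY² : 16 * b * X * Y ≤ X * X + a * (Y * Y)
      16bXY≤X²+aY² = ≤-by-certificate (4032 * b * b * Y * Y)
        (2mn≤m²+n² X (8 * b * Y) ⊞ (Y * Y) ⊠ 4096b²≤a) (solve (a ∷ b ∷ X ∷ Y ∷ []))

    -- The polynomial on the left is majorant (Rₑ x y z) of Descent, with X, Y, Z, W the absolute values.
    remainder-small : ∀ {Z} → a * Z ≤ W + b * Y + X →
      4 * (W * (a * b * X * Y + 2 * a * Y * Z + X * Y + b * X * Z)
           + (a * Y * Y * Y + b * b * X * Y * Z + b * X * X * Z + X * X * Y
              + b * b * Y * Y * Y + b * Y * Z * Z + X * Z * Z))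
        ≤ 3 * a * W * G
    remainder-small {Z} aZ≤ = *-cancelˡ-≤ (a * a) (*-cancelˡ-≤ 16 (≤-by-certificate
      (35 * a * a * a * W * G + 3270 * a * a * b * b * W * G + 3840 * a * b * b * b * W * G
        + 2438 * a * b * b * W * G + 3904 * b * b * b * Y * Y * Y + 3904 * b * b * X * Y * Y
        + 1792 * b * b * W * G + 15 * b * Y * G)
      ( (128 * a * a * Y * W + 64 * a * b * b * X * Y + 64 * a * b * X * X + 64 * a * b * X * W)
          ⊠ aZ≤
      ⊞ (64 * b * Y + 64 * X) ⊠ square-sum≤ W (b * Y) X aZ≤
      ⊞ (8 * a * a * G + 12 * a * b * b * G + 13 * b * G) ⊠ 16Y≤aW
      ⊞ (64 * a * b * G + 64 * b * b * b * G + 193 * G) ⊠ X≤4aW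
      ⊞ (128 * a * a * W + 192 * b * W) ⊠ YW≤4G
      ⊞ (32 * a * b * W + 96 * W) ⊠ 2XW≤aG+16G
      ⊞ (4 * a * a * a * W + 12 * a * a * W + 8 * a * b * W) ⊠ 16bXY≤G
      ⊞ (64 * a * a * Y + 128 * a * b * b * Y + 64 * a * b * X + 128 * a * b * W + 192 * b * Y
          + 192 * X) ⊠ X²≤G
      ⊞ (64 * a * a * Y + 64 * a * b * b * Y + 128 * a * b * W + 64 * b * b * b * X + b * Y + X)
          ⊠ aY²≤G
      ⊞ (a * a * W * G + a * b * W * G + a * W * G + b * Y * Y * Y + X * Y * Y + W * G) ⊠ 4096b²≤a
      ⊞ (814 * a * a * b * W * G + 192 * a * a * X * Y * W + 525 * a * a * W * G
          + 1658 * a * b * W * G + 869 * a * W * G + 2304 * b * W * G + 1536 * W * G) ⊠ 1≤b)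
      (solve (a ∷ b ∷ X ∷ Y ∷ Z ∷ W ∷ G ∷ []))))

  WG≤4 : ∀ {W G Q N} → a * G ≤ Q → W * Q ≤ a + N → 4 * N ≤ 3 * a * W * G → W * G ≤ 4
  WG≤4 {W} {G} {Q} {N} aG≤Q WQ≤a+N 4N≤3aWG = *-cancelˡ-≤ a
    (≤-by-certificate 0 ((4 * W) ⊠ aG≤Q ⊞ 4 ⊠ WQ≤a+N ⊞ 4N≤3aWG) (solve (a ∷ W ∷ G ∷ Q ∷ N ∷ [])))

  WG≤4⇒Y≡0×Z≡0 : ∀ {X Y Z W G} → X * X + a * (Y * Y) ≤ G → 1 ≤ W → 1 ≤ G → W * G ≤ 4 →
    a * Z ≤ W + b * Y + X → Y ≡ 0 × Z ≡ 0
  WG≤4⇒Y≡0×Z≡0 {X} {Y} {Z} {W} {G} G-bound 1≤W 1≤G WG≤4 aZ≤ = Y≡0 , Z≡0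
    where
    G≤4 : G ≤ 4
    G≤4 = ≤-trans (m≤n*m G W {{>-nonZero 1≤W}}) WG≤4
    W≤4 : W ≤ 4
    W≤4 = ≤-trans (m≤m*n W G {{>-nonZero 1≤G}}) WG≤4
    Y≡0 : Y ≡ 0
    Y≡0 = square≡0⇒≡0 (small-multiple≡0 (≤-trans (m≤m+n 5 4091) 4096≤a)
      (≤-trans (m≤n+m (a * (Y * Y)) (X * X)) (≤-trans G-bound G≤4)))
    X≤2 : X ≤ 2
    X≤2 = square-≤⇒≤ (≤-trans (m≤m+n (X * X) (a * (Y * Y))) (≤-trans G-bound G≤4))
    Z≡0 : Z ≡ 0
    Z≡0 = small-multiple≡0 (≤-trans (m≤m+n 7 4089) 4096≤a) (≤-trans aZ≤
      (W≤4 ⊞ ≤-reflexive (trans (cong (b *_) Y≡0) (*-zeroʳ b)) ⊞ X≤2))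

module Descent {a b : ℕ} (1≤b : 1 ≤ b) (4096b²≤a : 4096 * b * b ≤ a) where
  open Estimates 1≤b 4096b²≤a

  A B : ℤ
  A = + a
  B = + b

  Solution : ℤ → ℤ → ℤ → Set
  Solution x y z = P A B x y z ≡ + 1

  G : ℤ → ℤ → ℕ
  G x y = ∣ x ∣ * ∣ x ∣ + a * (∣ y ∣ * ∣ y ∣)

  W : ℤ → ℤ → ℤ → ℕ
  W x y z = ∣ next A B x y z ∣

  measure : ℤ → ℤ → ℤ → ℕ
  measure x y z = G x y + W x y z * W x y z

  ∣next∣≤ : ∀ x y z → W x y z ≤ a * ∣ z ∣ + b * ∣ y ∣ + ∣ x ∣
  ∣next∣≤ x y z = ∣⟦⟧∣≤majorant (at nextₑ A B x y z)

  ∣prev∣≤ : ∀ x y z → ∣ prev A B x y z ∣ ≤ ∣ z ∣ + a * ∣ y ∣ + b * ∣ x ∣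
  ∣prev∣≤ x y z = ∣⟦⟧∣≤majorant (at prevₑ A B x y z)

  a∣z∣≤ : ∀ x y z → a * ∣ z ∣ ≤ W x y z + b * ∣ y ∣ + ∣ x ∣
  a∣z∣≤ x y z = begin
    a * ∣ z ∣                             ≡⟨ ℤₚ.abs-* A z ⟨
    ∣ A ℤ.* z ∣                           ≡⟨ cong ∣_∣ (Az≡next-By-x A B x y z) ⟩
    ∣ next A B x y z ℤ.- B ℤ.* y ℤ.- x ∣
      ≤⟨ ∣⟦⟧∣≤majorant (Κ (next A B x y z) :- Κ B :* Κ y :- Κ x) ⟩
    W x y z + b * ∣ y ∣ + ∣ x ∣           ∎
    where open ≤-Reasoning

  ∣Q∣≡ : ∀ x y z → ∣ Q A B x y z ∣ ≡ a * G x y + ∣ z ∣ * ∣ z ∣ + b * (∣ y ∣ * ∣ y ∣)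
  ∣Q∣≡ x y z rewrite square≡+∣∣² x | square≡+∣∣² y | square≡+∣∣² z
    | sym (ℤₚ.pos-* a (∣ y ∣ * ∣ y ∣)) | sym (ℤₚ.pos-* b (∣ y ∣ * ∣ y ∣))
    | sym (ℤₚ.pos-* a (G x y)) = refl

  origin-not-solution : ∀ {x y z} → x ≡ + 0 → y ≡ + 0 → z ≡ + 0 → ¬ Solution x y z
  origin-not-solution refl refl refl sol with trans (sym (P-x00 A B (+ 0))) sol
  ... | ()

  1≤measure : ∀ x y z → Solution x y z → 1 ≤ measure x y z
  1≤measure x y z sol = n≢0⇒n>0 λ measure≡0′ →
    let X≡0 , Y≡0 , Z≡0 = measure≡0 (a∣z∣≤ x y z) measure≡0′
    in origin-not-solution (ℤₚ.∣i∣≡0⇒i≡0 X≡0) (ℤₚ.∣i∣≡0⇒i≡0 Y≡0) (ℤₚ.∣i∣≡0⇒i≡0 Z≡0) sol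

  measure-F-< : ∀ {x y z} → Solution x y z → 16 * (a * a * (W x y z * W x y z)) ≤ G x y →
    measure y z (next A B x y z) < measure x y z
  measure-F-< {x} {y} {z} sol W-small = F-step-decreases
    (m≤m+n _ _) (m≤n+m _ _) (1≤G-in-regime-F (1≤measure x y z sol) W-small) W-small
    (a∣z∣≤ x y z) (∣next∣≤ y z (next A B x y z))

  measure-Finv-< : ∀ {x y z} → Solution x y z → 16 * (a * G x y) ≤ W x y z * W x y z →
    measure (prev A B x y z) x y < measure x y z
  measure-Finv-< {x} {y} {z} sol W-large =
    subst (λ t → G (prev A B x y z) x + ∣ t ∣ * ∣ t ∣ < measure x y z) (sym (next-prev A B x y z))
      (Finv-step-decreases (m≤m+n _ _) (m≤n+m _ _)
        (1≤S-in-regime-Finv (1≤measure x y z sol) W-large) W-large (a∣z∣≤ x y z) (∣prev∣≤ x y z))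

  Rₑ : ℤ → ℤ → ℤ → Expr ℤ 0
  Rₑ x y z = Κ (next A B x y z) :* at Dₑ A B x y z :+ at Eₑ A B x y z

  A≡wQ+R : ∀ {x y z} → Solution x y z → A ≡ next A B x y z ℤ.* Q A B x y z ℤ.+ ⟦ Rₑ x y z ⟧₀
  A≡wQ+R {x} {y} {z} sol = begin
    A                    ≡⟨ ℤₚ.*-identityʳ A ⟨
    A ℤ.* + 1            ≡⟨ cong (A ℤ.*_) sol ⟨
    A ℤ.* P A B x y z    ≡⟨ P-decomposition A B x y z ⟩
    next A B x y z ℤ.* Q A B x y z ℤ.+ ⟦ Rₑ x y z ⟧₀ ∎
    where open ≡-Reasoning

  W∣Q∣≤a+majorant : ∀ {x y z} → Solution x y z → W x y z * ∣ Q A B x y z ∣ ≤ a + majorant (Rₑ x y z)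
  W∣Q∣≤a+majorant {x} {y} {z} sol = begin
    W x y z * ∣ Q A B x y z ∣            ≡⟨ ℤₚ.abs-* w (Q A B x y z) ⟨
    ∣ w ℤ.* Q A B x y z ∣                ≤⟨ ∣i∣≤∣i+j∣+∣j∣ (w ℤ.* Q A B x y z) R ⟩
    ∣ w ℤ.* Q A B x y z ℤ.+ R ∣ + ∣ R ∣  ≡⟨ cong (λ t → ∣ t ∣ + ∣ R ∣) (A≡wQ+R sol) ⟨
    a + ∣ R ∣                            ≤⟨ +-monoʳ-≤ a (∣⟦⟧∣≤majorant (Rₑ x y z)) ⟩
    a + majorant (Rₑ x y z)              ∎
    where
    open ≤-Reasoning
    w R : ℤ
    w = next A B x y z
    R = ⟦ Rₑ x y z ⟧₀

  aG≤∣Q∣ : ∀ x y z → a * G x y ≤ ∣ Q A B x y z ∣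
  aG≤∣Q∣ x y z = subst (a * G x y ≤_) (sym (∣Q∣≡ x y z)) (≤-trans (m≤m+n _ _) (m≤m+n _ _))

  middle-solution : ∀ {x y z} → Solution x y z → G x y < 16 * (a * a * (W x y z * W x y z)) →
    W x y z * W x y z < 16 * (a * G x y) → (x , y , z) ≡ (+ 1 , + 0 , + 0)
  middle-solution {x} {y} {z} sol W-not-small W-not-large = cong₂ _,_ x≡1 (cong₂ _,_ y≡0 z≡0)
    where
    open Middle {∣ x ∣} {∣ y ∣} {W x y z} {G x y} ≤-refl W-not-small W-not-large

    ∣y∣≡0×∣z∣≡0 : ∣ y ∣ ≡ 0 × ∣ z ∣ ≡ 0
    ∣y∣≡0×∣z∣≡0 = WG≤4⇒Y≡0×Z≡0 ≤-refl 1≤W 1≤G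
      (WG≤4 (aG≤∣Q∣ x y z) (W∣Q∣≤a+majorant sol) (remainder-small (a∣z∣≤ x y z))) (a∣z∣≤ x y z)

    y≡0 : y ≡ + 0
    y≡0 = ℤₚ.∣i∣≡0⇒i≡0 (proj₁ ∣y∣≡0×∣z∣≡0)

    z≡0 : z ≡ + 0
    z≡0 = ℤₚ.∣i∣≡0⇒i≡0 (proj₂ ∣y∣≡0×∣z∣≡0)

    x≡1 : x ≡ + 1
    x≡1 = cube≡1⇒≡1 x (trans (sym (P-x00 A B x)) (subst₂ (λ s t → P A B x s t ≡ + 1) y≡0 z≡0 sol))

  solution-in-orbit : ∀ x y z → Acc _<_ (measure x y z) → Solution x y z →
    Orbit A B (+ 1 , + 0 , + 0) (x , y , z)
  solution-in-orbit x y z (acc smaller) sol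
    with 16 * (a * a * (W x y z * W x y z)) ≤? G x y | 16 * (a * G x y) ≤? W x y z * W x y z
  ... | yes W-small | _ = orbit-F⁻¹ (solution-in-orbit y z (next A B x y z)
         (smaller (measure-F-< sol W-small)) (trans (P-F-invariant A B x y z) sol))
  ... | no _ | yes W-large = orbit-Finv⁻¹ (solution-in-orbit (prev A B x y z) x y
         (smaller (measure-Finv-< sol W-large)) (trans (P-Finv-invariant A B x y z) sol))
  ... | no W-not-small | no W-not-large =
         + 0 , sym (middle-solution sol (≰⇒> W-not-small) (≰⇒> W-not-large))

theorem4p4 : (b : ℕ) → 1 ≤ b →
    ∃ λ (A : ℕ) → (a : ℕ) → A ≤ a → 1 ≤ a →
      IrreducibleQ (cubic (+ a) (+ b)) →
      Σ (List ℤ³) λ 𝓕 →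
        All (λ s → P (+ a) (+ b) (proj₁ s) (proj₁ (proj₂ s)) (proj₂ (proj₂ s)) ≡ + 1) 𝓕 ×
        ((x y z : ℤ) → P (+ a) (+ b) x y z ≡ + 1 →
          ∃ λ s → s ∈ 𝓕 × ∃ λ (n : ℤ) → Fpow (+ a) (+ b) n s ≡ (x , y , z))
theorem4p4 b 1≤b = 4096 * b * b , λ a 4096b²≤a _ _ → let open Descent 1≤b 4096b²≤a in
  (+ 1 , + 0 , + 0) ∷ [] , P-x00 (+ a) (+ b) (+ 1) All.∷ All.[] ,
  λ x y z sol → (+ 1 , + 0 , + 0) , here refl ,
    solution-in-orbit x y z (<-wellFounded (measure x y z)) sol
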